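{- Let $X_0\xrightarrow{f_1}X_1\xrightarrow{f_2}\cdots\xrightarrow{f_n}X_n$ be a sequence of surjective continuous maps of topological spaces such that, for each $i=0,\dots,n-1$, $X_i$ has the local product structure property with respect to $f_{i+1}$ at every point of a dense subset $Z_i\subseteq X_i$. If $B\subseteq X_n$ is dense, then for every $0\le i\le n-1$ the preimage $(f_n\circ\cdots\circ f_{i+1})^{ -1}(B)$ is dense in $X_i$.
   Context: Local product structure: for a surjective continuous map $f:X\to Y$ and $x_0\in X$, $y_0=f(x_0)$, $X$ has the local product structure property at $x_0$ with respect to $f$ if there exist a topological space $F_{x_0}$, open sets $O\subseteq X$, $U\subseteq F_{x_0}$, $V\subseteq Y$ with $x_0\in O$, $y_0\in V$, and a homeomorphism $\psi:O\to U\times V$ with $f|_O=\pi_2\circ\psi$, where $\pi_2:U\times V\to V$ is the projection. -}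

module Defs where

open import Data.Nat using (ℕ; zero; suc; _+_)
open import Data.Product using (Σ; _×_; _,_; proj₁; proj₂)
open import Data.Unit using (⊤)
open import Relation.Binary.PropositionalEquality using (_≡_)

record Topology (X : Set) : Set₂ where
  field
    Open     : (X → Set) → Set₁
    open-ext : ∀ {U V : X → Set} → Open U →
               (∀ x → U x → V x) → (∀ x → V x → U x) → Open V
    open-univ : Open (λ _ → ⊤)
    open-∩   : ∀ {U V : X → Set} → Open U → Open V → Open (λ x → U x × V x)
    open-⋃   : (I : Set) (U : I → X → Set) → (∀ i → Open (U i)) →
               Open (λ x → Σ I (λ i → U i x))

open Topology public

subspace : {X : Set} → Topology X → (S : X → Set) → Topology (Σ X S)
subspace {X} τ S = record
  { Open = λ W → Σ (X → Set) λ G → Open τ G ×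
                   ((p : Σ X S) → (W p → G (proj₁ p)) × (G (proj₁ p) → W p))
  ; open-ext = λ { (G , oG , e) UV VU →
      G , oG , λ p → (λ v → proj₁ (e p) (VU p v)) , (λ g → UV p (proj₂ (e p) g)) }
  ; open-univ = (λ _ → ⊤) , open-univ τ , λ p → (λ _ → _) , (λ _ → _)
  ; open-∩ = λ { (G , oG , e) (H , oH , e') →
      (λ x → G x × H x) , open-∩ τ oG oH ,
      λ p → (λ { (u , v) → proj₁ (e p) u , proj₁ (e' p) v })
          , (λ { (g , h) → proj₂ (e p) g , proj₂ (e' p) h }) }
  ; open-⋃ = λ I U oU →
      (λ x → Σ I λ i → proj₁ (oU i) x) ,
      open-⋃ τ I (λ i → proj₁ (oU i)) (λ i → proj₁ (proj₂ (oU i))) ,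
      λ p → (λ { (i , u) → i , proj₁ (proj₂ (proj₂ (oU i)) p) u })
          , (λ { (i , g) → i , proj₂ (proj₂ (proj₂ (oU i)) p) g })
  }

product : {A B : Set} → Topology A → Topology B → Topology (A × B)
product {A} {B} τ σ = record
  { Open = λ W → (p : A × B) → W p →
       Σ (A → Set) λ U → Σ (B → Set) λ V →
         Open τ U × Open σ V × U (proj₁ p) × V (proj₂ p) ×
         (∀ a b → U a → V b → W (a , b))
  ; open-ext = λ oW UV VU p v →
      let (U , V , oU , oV , u , w , k) = oW p (VU p v)
      in U , V , oU , oV , u , w , λ a b x y → UV (a , b) (k a b x y)
  ; open-univ = λ p _ → (λ _ → ⊤) , (λ _ → ⊤) , open-univ τ , open-univ σ , _ , _ , λ _ _ _ _ → _
  ; open-∩ = λ oW oW' p w →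
      let (U , V , oU , oV , u , v , k) = oW p (proj₁ w)
          (U' , V' , oU' , oV' , u' , v' , k') = oW' p (proj₂ w)
      in (λ a → U a × U' a) , (λ b → V b × V' b) , open-∩ τ oU oU' , open-∩ σ oV oV' ,
         (u , u') , (v , v') , λ a b x y → k a b (proj₁ x) (proj₁ y) , k' a b (proj₂ x) (proj₂ y)
  ; open-⋃ = λ I W oW p w →
      let (i , wi) = w
          (U , V , oU , oV , u , v , k) = oW i p wi
      in U , V , oU , oV , u , v , λ a b x y → i , k a b x y
  }

Continuous : {A B : Set} → Topology A → Topology B → (A → B) → Set₁
Continuous τ σ g = ∀ W → Open σ W → Open τ (λ a → W (g a))

Surjective : {A B : Set} → (A → B) → Set
Surjective {A} {B} g = (y : B) → Σ A λ x → g x ≡ y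

record Homeomorphism {A B : Set} (τ : Topology A) (σ : Topology B) : Set₁ where
  field
    to      : A → B
    from    : B → A
    from∘to : ∀ a → from (to a) ≡ a
    to∘from : ∀ b → to (from b) ≡ b
    to-cont   : Continuous τ σ to
    from-cont : Continuous σ τ from

open Homeomorphism public

Dense : {X : Set} → Topology X → (X → Set) → Set₁
Dense {X} τ Z = (W : X → Set) → Open τ W → Σ X W → Σ X λ x → W x × Z x

LocalProduct : {X Y : Set} → Topology X → Topology Y → (X → Y) → X → Set₂
LocalProduct {X} {Y} τX τY f x₀ =
  Σ Set λ F → Σ (Topology F) λ τF →
  Σ (X → Set) λ O → Σ (F → Set) λ U → Σ (Y → Set) λ V →
    Open τX O × Open τF U × Open τY V × O x₀ × V (f x₀) ×
    Σ (Homeomorphism (subspace τX O) (product (subspace τF U) (subspace τY V))) λ ψ →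
      (p : Σ X O) → proj₁ (proj₂ (to ψ p)) ≡ f (proj₁ p)

-- Iterated composition f_{i+k} ∘ ⋯ ∘ f_{i+1} : X_i → X_{k+i}
-- (here f m : X_m → X_{m+1} plays the role of f_{m+1} in the paper).
comp : {C : ℕ → Set} → ((m : ℕ) → C m → C (suc m)) →
       (i k : ℕ) → C i → C (k + i)
comp f i zero x = x
comp f i (suc k) x = f (k + i) (comp f i k x)

{-# OPTIONS --safe #-}
module Submission where

-- A local product chart ψ : O ≅ U × V with f = π₂ ∘ ψ makes f open at every point of O:
-- a neighbourhood of x contains a box around ψ x, whose second factor is a neighbourhood
-- of f x lying in the image.  A map that is open at the points of a dense set pulls dense
-- sets back to dense sets: a nonempty open W contains such a point x, f(W) is then a
-- neighbourhood of f x, and it meets the dense set B.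

open import Defs
open import Data.Nat using (ℕ; suc; zero; _+_; _<_; _≤_)
open import Data.Nat.Properties using (≤-refl; <⇒≤)
open import Data.Product using (_×_; Σ; _,_; proj₁; proj₂)
open import Relation.Binary.PropositionalEquality using (_≡_; subst; refl; sym; trans; cong)

OpenAt : {X Y : Set} → Topology X → Topology Y → (X → Y) → X → Set₁
OpenAt {X} {Y} τX τY g x =
  ∀ W → Open τX W → W x →
  Σ (Y → Set) λ N → Open τY N × N (g x) × (∀ y → N y → Σ X λ x′ → W x′ × g x′ ≡ y)

open-restrict : {X : Set} (τ : Topology X) (S : X → Set) {W : X → Set} →
                Open τ W → Open (subspace τ S) (λ p → W (proj₁ p))
open-restrict τ S {W} oW = W , oW , λ _ → (λ w → w) , (λ w → w)

localProduct⇒openAt : {X Y : Set} (τX : Topology X) (τY : Topology Y) (g : X → Y) (x : X) →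
                      LocalProduct τX τY g x → OpenAt τX τY g x
localProduct⇒openAt τX τY g x (F , τF , O , U , V , oO , oU , oV , Ox , Vgx , ψ , ψ-fibre) W oW Wx
  with from-cont ψ _ (open-restrict τX O oW) (to ψ (x , Ox)) Wψ⁻¹ψx
  where
  Wψ⁻¹ψx : W (proj₁ (from ψ (to ψ (x , Ox))))
  Wψ⁻¹ψx = subst (λ p → W (proj₁ p)) (sym (from∘to ψ (x , Ox))) Wx
... | U′ , V′ , oU′ , (G , oG , V′≈G) , u′ , v′ , box⊆W =
  (λ y → G y × V y) , open-∩ τY oG oV , (G-gx , Vgx) , lift
  where
  ψx = to ψ (x , Ox)

  G-gx : G (g x)
  G-gx = subst G (ψ-fibre (x , Ox)) (proj₁ (V′≈G (proj₂ ψx)) v′)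

  lift : ∀ y → G y × V y → Σ _ λ x′ → W x′ × g x′ ≡ y
  lift y (Gy , Vy) = proj₁ (from ψ b) , box⊆W _ _ u′ (proj₂ (V′≈G (y , Vy)) Gy) , g-b
    where
    b = proj₁ ψx , (y , Vy)

    g-b : g (proj₁ (from ψ b)) ≡ y
    g-b = trans (sym (ψ-fibre (from ψ b))) (cong (λ c → proj₁ (proj₂ c)) (to∘from ψ b))

dense-preimage : {X Y : Set} (τX : Topology X) (τY : Topology Y) (g : X → Y) (Z : X → Set) →
                 Dense τX Z → (∀ x → Z x → OpenAt τX τY g x) →
                 (B : Y → Set) → Dense τY B → Dense τX (λ x → B (g x))
dense-preimage τX τY g Z dZ g-open B dB W oW W≢∅
  with dZ W oW W≢∅
... | x , Wx , Zx with g-open x Zx W oW Wx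
... | N , oN , Ngx , lift with dB N oN (g x , Ngx)
... | y , Ny , By with lift y Ny
... | x′ , Wx′ , gx′≡y = x′ , Wx′ , subst B (sym gx′≡y) By

comp-dense-preimage : (n : ℕ) (C : ℕ → Set) (T : (m : ℕ) → Topology (C m))
  (f : (m : ℕ) → C m → C (suc m)) (Z : (m : ℕ) → C m → Set) →
  (∀ m → m < n → Dense (T m) (Z m) × (∀ x → Z m x → OpenAt (T m) (T (suc m)) (f m) x)) →
  (k i : ℕ) → suc k + i ≤ n → (B : C (suc k + i) → Set) → Dense (T (suc k + i)) B →
  Dense (T i) (λ x → B (comp f i (suc k) x))
comp-dense-preimage n C T f Z H zero i le B dB =
  dense-preimage (T i) (T (suc i)) (f i) (Z i) (proj₁ (H i le)) (proj₂ (H i le)) B dB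
comp-dense-preimage n C T f Z H (suc k) i le B dB =
  comp-dense-preimage n C T f Z H k i (<⇒≤ le) (λ y → B (f (suc k + i) y))
    (dense-preimage (T (suc k + i)) (T (suc (suc k + i))) (f (suc k + i)) (Z (suc k + i))
      (proj₁ (H _ le)) (proj₂ (H _ le)) B dB)

mainTheorem14 : (n : ℕ) (C : ℕ → Set) (T : (m : ℕ) → Topology (C m))
    (f : (m : ℕ) → C m → C (suc m)) →
    (∀ i → i < n → Surjective (f i) × Continuous (T i) (T (suc i)) (f i)) →
    (Z : (i : ℕ) → C i → Set) →
    (∀ i → i < n → Dense (T i) (Z i) ×
      (∀ x → Z i x → LocalProduct (T i) (T (suc i)) (f i) x)) →
    (B : C n → Set) → Dense (T n) B →
    (i k : ℕ) (eq : suc k + i ≡ n) →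
    Dense (T i) (λ x → B (subst C eq (comp f i (suc k) x)))
mainTheorem14 .(suc k + i) C T f _ Z H B dB i k refl =
  comp-dense-preimage _ C T f Z openAt-on-Z k i ≤-refl B dB
  where
  openAt-on-Z : ∀ m → m < suc k + i →
    Dense (T m) (Z m) × (∀ x → Z m x → OpenAt (T m) (T (suc m)) (f m) x)
  openAt-on-Z m m<n = proj₁ (H m m<n) ,
    λ x Zx → localProduct⇒openAt (T m) (T (suc m)) (f m) x (proj₂ (H m m<n) x Zx)
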